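{- (i) If $\Delta\vdash M:B$ is a valid typing judgment and $x$ is a variable of $\Delta$ with $x\notin \mathrm{FV}(M)$, then $\Delta(x)={!A}$ for some type $A$. (ii) Conversely, if $\Delta\vdash M:B$ is valid and $x\notin\mathrm{FV}(M)$ is a variable not occurring in $\Delta$, then for every type $A$ the typing judgment $\Delta,x:{!A}\vdash M:B$ is valid.
   Context: Types: $A,B ::= \alpha \mid (A\multimap B)\mid (A\otimes B)\mid \mathbf{1}\mid {!A}$, with $\alpha$ ranging over a fixed set of type constants; ${!^n}A$ denotes $A$ preceded by $n$ copies of $!$. Subtyping $<:$ is the least relation closed under the following rules, each usable whenever the integers $n,m\ge 0$ satisfy ($m=0$ or $n\ge 1$): ${!^n}\alpha<:{!^m}\alpha$; ${!^n}\mathbf{1}<:{!^m}\mathbf{1}$; if $A<:A'$ and $B<:B'$ then ${!^n}(A'\multimap B)<:{!^m}(A\multimap B')$; if $A<:A'$ and $B<:B'$ then ${!^n}(A\otimes B)<:{!^m}(A'\otimes B')$. Indexed terms ($n$ a nonnegative integer, $x,y$ variables, $c$ from a set of constants, each constant $c$ being assigned a type ${!A_c}$): core values $U ::= x^A \mid c^A \mid *^n \mid \lambda^n x^A.M$; values $V,W ::= U \mid \langle V,W\rangle^n \mid (\lambda^0x^A.W)V \mid \mathrm{let}\ \langle x^A,y^B\rangle^n=V\ \mathrm{in}\ W \mid \mathrm{let}\ *=V\ \mathrm{in}\ W$; terms $M,N ::= U\mid \langle M,N\rangle^n\mid MN\mid \mathrm{let}\ \langle x^A,y^B\rangle^n=M\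 \mathrm{in}\ N\mid \mathrm{let}\ *=M\ \mathrm{in}\ N$. $\mathrm{FV}(M)$ is the set of free variables of $M$ ($\lambda^n x^A.M$ binds $x$; $\mathrm{let}\ \langle x^A,y^B\rangle^n=M\ \mathrm{in}\ N$ binds $x,y$ in $N$). A context is a finite list $x_1:A_1,\dots,x_k:A_k$ of distinct variables with types; $\Delta(x)$ is the type assigned to $x$; $\Gamma,\Delta$ denotes juxtaposition of contexts with disjoint variables; ${!\Delta}$ denotes a context all of whose types are of the form ${!B}$. A typing judgment $\Delta\vdash M:A$ is valid if derivable by the rules: (ax1) ${!\Delta},x:A\vdash x^B:B$ if $A<:B$; (ax2) ${!\Delta}\vdash c^B:B$ if $A_c<:B$; (app) from $\Gamma_1,{!\Delta}\vdash M:A\multimap B$ and $\Gamma_2,{!\Delta}\vdash N:A$ infer $\Gamma_1,\Gamma_2,{!\Delta}\vdash MN:B$; ($\lambda_1$) from $\Delta,x:A\vdash M:B$ infer $\Delta\vdash\lambda^0x^A.M:A\multimap B$; ($\lambda_2$) from ${!\Delta},x:A\vdash M:B$ infer ${!\Delta}\vdash \lambda^{n+1}x^A.M:{!^{n+1}}(A\multimap B)$; ($\mathbf 1$.I) ${!\Delta}\vdash *^n:{!^n}\mathbf{1}$; ($\otimes$.I) from ${!\Delta},\Gamma_1\vdash M_1:{!^n}A_1$ and ${!\Delta},\Gamma_2\vdash M_2:{!^n}A_2$ infer ${!\Delta},\Gamma_1,\Gamma_2\vdash\langle M_1,M_2\rangle^n:{!^n}(A_1\otimes A_2)$; ($\mathbf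 1$.E) from ${!\Delta},\Gamma_1\vdash M:\mathbf{1}$ and ${!\Delta},\Gamma_2\vdash N:A$ infer ${!\Delta},\Gamma_1,\Gamma_2\vdash \mathrm{let}\ *=M\ \mathrm{in}\ N:A$; ($\otimes$.E) from ${!\Delta},\Gamma_1\vdash M:{!^n}(A_1\otimes A_2)$ and ${!\Delta},\Gamma_2,x_1:{!^n}A_1,x_2:{!^n}A_2\vdash N:A$ infer ${!\Delta},\Gamma_1,\Gamma_2\vdash \mathrm{let}\ \langle x_1^{A_1},x_2^{A_2}\rangle^n=M\ \mathrm{in}\ N:A$. -}

module Defs where

open import Data.Nat using (ℕ; zero; suc; _≤_)
open import Data.Product using (Σ; _×_; _,_; proj₁; proj₂)
open import Data.Sum using (_⊎_)
open import Data.List using (List; []; _∷_; _++_; map; [_])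
open import Data.List.Relation.Unary.All using (All)
open import Data.List.Relation.Unary.Unique.Propositional using (Unique)
open import Data.List.Relation.Binary.Permutation.Propositional using (_↭_)
open import Relation.Binary.PropositionalEquality using (_≡_)
open import Relation.Nullary using (¬_)

data Ty (TC : Set) : Set where
  tc  : TC → Ty TC
  _⊸_ : Ty TC → Ty TC → Ty TC
  _⊗_ : Ty TC → Ty TC → Ty TC
  𝟏   : Ty TC
  !_  : Ty TC → Ty TC

infixr 25 _⊸_
infixr 26 _⊗_
infix 30 !_

bangs : {TC : Set} → ℕ → Ty TC → Ty TC
bangs zero    A = A
bangs (suc n) A = ! bangs n A

SubCond : ℕ → ℕ → Set
SubCond n m = (m ≡ 0) ⊎ (1 ≤ n)

data _<:_ {TC : Set} : Ty TC → Ty TC → Set where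
  sub-α : ∀ {n m} (α : TC) → SubCond n m → bangs n (tc α) <: bangs m (tc α)
  sub-𝟏 : ∀ {n m} → SubCond n m → bangs n 𝟏 <: bangs m 𝟏
  sub-⊸ : ∀ {n m A A' B B'} → SubCond n m → A <: A' → B <: B' →
          bangs n (A' ⊸ B) <: bangs m (A ⊸ B')
  sub-⊗ : ∀ {n m A A' B B'} → SubCond n m → A <: A' → B <: B' →
          bangs n (A ⊗ B) <: bangs m (A' ⊗ B')

infix 4 _<:_

Var : Set
Var = ℕ

-- Indexed terms (values are a subclass of terms and are not needed here)
data Tm (TC K : Set) : Set where
  var     : Var → Ty TC → Tm TC K
  const   : K → Ty TC → Tm TC K
  star    : ℕ → Tm TC K
  lam     : ℕ → Var → Ty TC → Tm TC K → Tm TC K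
  pair    : ℕ → Tm TC K → Tm TC K → Tm TC K
  app     : Tm TC K → Tm TC K → Tm TC K
  letpair : ℕ → Var → Ty TC → Var → Ty TC →
            Tm TC K → Tm TC K → Tm TC K
  letunit : Tm TC K → Tm TC K → Tm TC K

data FreeIn {TC K : Set} (x : Var) : Tm TC K → Set where
  fv-var  : ∀ {A} → FreeIn x (var x A)
  fv-lam  : ∀ {n y A M} → ¬ (x ≡ y) → FreeIn x M → FreeIn x (lam n y A M)
  fv-pairˡ : ∀ {n M N} → FreeIn x M → FreeIn x (pair n M N)
  fv-pairʳ : ∀ {n M N} → FreeIn x N → FreeIn x (pair n M N)
  fv-appˡ : ∀ {M N} → FreeIn x M → FreeIn x (app M N)
  fv-appʳ : ∀ {M N} → FreeIn x N → FreeIn x (app M N)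
  fv-letpairˡ : ∀ {n y A z B M N} → FreeIn x M → FreeIn x (letpair n y A z B M N)
  fv-letpairʳ : ∀ {n y A z B M N} → ¬ (x ≡ y) → ¬ (x ≡ z) → FreeIn x N →
                FreeIn x (letpair n y A z B M N)
  fv-letunitˡ : ∀ {M N} → FreeIn x M → FreeIn x (letunit M N)
  fv-letunitʳ : ∀ {M N} → FreeIn x N → FreeIn x (letunit M N)

-- x occurs as a binder somewhere in M (λ or let-pair binder).  Used to express
-- the Barendregt variable convention (terms up to α-equivalence).
data BoundIn {TC K : Set} (x : Var) : Tm TC K → Set where
  bv-lam    : ∀ {n A M} → BoundIn x (lam n x A M)
  bv-lamᵢ   : ∀ {n y A M} → BoundIn x M → BoundIn x (lam n y A M)
  bv-pairˡ  : ∀ {n M N} → BoundIn x M → BoundIn x (pair n M N)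
  bv-pairʳ  : ∀ {n M N} → BoundIn x N → BoundIn x (pair n M N)
  bv-appˡ   : ∀ {M N} → BoundIn x M → BoundIn x (app M N)
  bv-appʳ   : ∀ {M N} → BoundIn x N → BoundIn x (app M N)
  bv-let₁   : ∀ {n A z B M N} → BoundIn x (letpair n x A z B M N)
  bv-let₂   : ∀ {n y A B M N} → BoundIn x (letpair n y A x B M N)
  bv-letˡ   : ∀ {n y A z B M N} → BoundIn x M → BoundIn x (letpair n y A z B M N)
  bv-letʳ   : ∀ {n y A z B M N} → BoundIn x N → BoundIn x (letpair n y A z B M N)
  bv-unitˡ  : ∀ {M N} → BoundIn x M → BoundIn x (letunit M N)
  bv-unitʳ  : ∀ {M N} → BoundIn x N → BoundIn x (letunit M N)

-- Contexts are taken up to permutation (each rule's conclusion may be any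
-- reordering of the juxtaposition) and must have distinct variables.
Cx : Set → Set
Cx TC = List (Var × Ty TC)

dom : {TC : Set} → Cx TC → List Var
dom = map proj₁

IsCtx : {TC : Set} → Cx TC → Set
IsCtx Γ = Unique (dom Γ)

IsBang : {TC : Set} → Ty TC → Set
IsBang {TC} A = Σ (Ty TC) (λ B → A ≡ ! B)

Banged : {TC : Set} → Cx TC → Set
Banged Δ = All (λ p → IsBang (proj₂ p)) Δ

module Typing (TC K : Set) (Aᶜ : K → Ty TC) where

  infix 3 _⊢_∶_

  data _⊢_∶_ : Cx TC → Tm TC K → Ty TC → Set where
    ax1 : ∀ {D Δ x A B} → Banged Δ → A <: B →
          D ↭ (Δ ++ [ (x , A) ]) → IsCtx D →
          D ⊢ var x B ∶ B
    ax2 : ∀ {D Δ c B} → Banged Δ → Aᶜ c <: B →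
          D ↭ Δ → IsCtx D →
          D ⊢ const c B ∶ B
    app : ∀ {D Γ₁ Γ₂ Δ M N A B} → Banged Δ →
          (Γ₁ ++ Δ) ⊢ M ∶ A ⊸ B → (Γ₂ ++ Δ) ⊢ N ∶ A →
          D ↭ (Γ₁ ++ Γ₂ ++ Δ) → IsCtx D →
          D ⊢ app M N ∶ B
    lam1 : ∀ {Δ x A M B} →
          (Δ ++ [ (x , A) ]) ⊢ M ∶ B → IsCtx Δ →
          Δ ⊢ lam 0 x A M ∶ A ⊸ B
    lam2 : ∀ {Δ x A M B n} → Banged Δ →
          (Δ ++ [ (x , A) ]) ⊢ M ∶ B → IsCtx Δ →
          Δ ⊢ lam (suc n) x A M ∶ bangs (suc n) (A ⊸ B)
    oneI : ∀ {Δ n} → Banged Δ → IsCtx Δ →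
          Δ ⊢ star n ∶ bangs n 𝟏
    tensorI : ∀ {D Δ Γ₁ Γ₂ M₁ M₂ A₁ A₂ n} → Banged Δ →
          (Δ ++ Γ₁) ⊢ M₁ ∶ bangs n A₁ → (Δ ++ Γ₂) ⊢ M₂ ∶ bangs n A₂ →
          D ↭ (Δ ++ Γ₁ ++ Γ₂) → IsCtx D →
          D ⊢ pair n M₁ M₂ ∶ bangs n (A₁ ⊗ A₂)
    oneE : ∀ {D Δ Γ₁ Γ₂ M N A} → Banged Δ →
          (Δ ++ Γ₁) ⊢ M ∶ 𝟏 → (Δ ++ Γ₂) ⊢ N ∶ A →
          D ↭ (Δ ++ Γ₁ ++ Γ₂) → IsCtx D →
          D ⊢ letunit M N ∶ A
    tensorE : ∀ {D Δ Γ₁ Γ₂ M N A A₁ A₂ x₁ x₂ n} → Banged Δ →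
          (Δ ++ Γ₁) ⊢ M ∶ bangs n (A₁ ⊗ A₂) →
          (Δ ++ Γ₂ ++ (x₁ , bangs n A₁) ∷ (x₂ , bangs n A₂) ∷ []) ⊢ N ∶ A →
          D ↭ (Δ ++ Γ₁ ++ Γ₂) → IsCtx D →
          D ⊢ letpair n x₁ A₁ x₂ A₂ M N ∶ A

module Submission where

-- Every typing
-- rule either places a variable in a banged part of its context (the !Δ of
-- the rule) or hands it to a premise whose term is a subterm; in the latter
-- case the variable is still not free in the subterm, since it is distinct
-- from the variables the rule binds (contexts have distinct variables).
--
-- (ii) Conversely a fresh variable of banged type can always be added: it is
-- put into the banged part !Δ of the last rule and, by induction, into the
-- premises (`weaken-!`).  Since the premises list the banged part first while
-- the new variable is appended last, we need the exchange rule `⊢-exchange`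
-- (derivable judgements are closed under permuting the context), and the
-- variable must not be rebound inside the term.  Weakening needs no
-- assumption on the free variables: a fresh variable cannot be free anyway.

open import Defs
open import Data.Product using (Σ; _×_; _,_; proj₁)
open import Data.Sum using (inj₁; inj₂)
open import Data.Empty using (⊥-elim)
open import Data.List using ([]; _∷_; _++_; [_])
open import Data.List.Properties using (++-assoc)
open import Data.List.Membership.Propositional using (_∈_; _∉_)
open import Data.List.Membership.Propositional.Properties using (∈-map⁺; ∈-++⁻; ∈-++⁺ˡ; ∈-++⁺ʳ)
open import Data.List.Relation.Unary.All using (All; []; _∷_; lookup)
import Data.List.Relation.Unary.All.Properties as All
open import Data.List.Relation.Unary.Any using (here; there)
open import Data.List.Relation.Unary.AllPairs using (_∷_)
open import Data.List.Relation.Binary.Permutation.Propositional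
  using (_↭_; ↭-reflexive; ↭-sym; ↭-trans; ↭⇒↭ₛ)
open import Data.List.Relation.Binary.Permutation.Propositional.Properties
  using (All-resp-↭; ∈-resp-↭; ++⁺ˡ; ++⁺ʳ; ++-comm)
  renaming (map⁺ to ↭-map⁺)
open import Data.List.Relation.Binary.Permutation.Setoid.Properties using (Unique-resp-↭)
open import Relation.Binary.PropositionalEquality using (_≡_; refl; sym; trans; cong; subst; setoid)
open import Relation.Nullary using (¬_)
open import Function using (_∘_)

module _ {TC : Set} where

  -- x is fresh for Γ: it differs from every variable declared in Γ.
  -- This is `x ∉ dom Γ` in a form that splits along _++_ and permutations.
  _#_ : Var → Cx TC → Set
  x # Γ = All (λ b → ¬ x ≡ proj₁ b) Γ

  ∉dom⇒# : ∀ {x} {Γ : Cx TC} → x ∉ dom Γ → x # Γ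
  ∉dom⇒# {Γ = Γ} x∉ = All.map⁻ (All.¬Any⇒All¬ (dom Γ) x∉)

  IsCtx-resp-↭ : ∀ {Γ Γ' : Cx TC} → IsCtx Γ → Γ ↭ Γ' → IsCtx Γ'
  IsCtx-resp-↭ u q = Unique-resp-↭ (setoid Var) (↭⇒↭ₛ (↭-map⁺ proj₁ q)) u

  IsCtx-snoc : ∀ {x T} {Γ : Cx TC} → x # Γ → IsCtx Γ → IsCtx (Γ ++ [ (x , T) ])
  IsCtx-snoc {x} {T} {Γ} fresh u =
    IsCtx-resp-↭ {Γ = (x , T) ∷ Γ} (All.map⁺ fresh ∷ u) (++-comm [ (x , T) ] Γ)

  Banged-snoc : ∀ {x A} {Γ : Cx TC} → Banged Γ → Banged (Γ ++ [ (x , ! A) ])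
  Banged-snoc b = All.++⁺ b ((_ , refl) ∷ [])

  distinct-++ : ∀ {x y T S} (Γ : Cx TC) {Θ : Cx TC} → IsCtx (Γ ++ Θ) →
                (x , T) ∈ Γ → (y , S) ∈ Θ → ¬ x ≡ y
  distinct-++ (_ ∷ Γ) (x≢ ∷ _) (here refl) y∈ = lookup x≢ (∈-map⁺ proj₁ (∈-++⁺ʳ Γ y∈))
  distinct-++ (_ ∷ Γ) (_ ∷ u)  (there x∈)  y∈ = distinct-++ Γ u x∈ y∈

  module Fresh-++₃ {x : Var} (Γ₁ Γ₂ : Cx TC) {Γ₃ : Cx TC} (fresh : x # (Γ₁ ++ Γ₂ ++ Γ₃)) where
    fresh₁ : x # Γ₁
    fresh₁ = All.++⁻ˡ Γ₁ fresh

    fresh₂ : x # Γ₂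
    fresh₂ = All.++⁻ˡ Γ₂ (All.++⁻ʳ Γ₁ fresh)

    fresh₃ : x # Γ₃
    fresh₃ = All.++⁻ʳ Γ₂ (All.++⁻ʳ Γ₁ fresh)

  shift-last : ∀ (Γ Θ : Cx TC) b → (Γ ++ Θ) ++ [ b ] ↭ (Γ ++ [ b ]) ++ Θ
  shift-last Γ Θ b =
    ↭-trans (↭-reflexive (++-assoc Γ Θ [ b ]))
      (↭-trans (++⁺ˡ Γ (++-comm Θ [ b ])) (↭-reflexive (sym (++-assoc Γ [ b ] Θ))))

module UnusedVariables (TC K : Set) (Aᶜ : K → Ty TC) where
  open Typing TC K Aᶜ

  ⊢-isCtx : ∀ {Γ M B} → Γ ⊢ M ∶ B → IsCtx Γ
  ⊢-isCtx (ax1 _ _ _ u)       = u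
  ⊢-isCtx (ax2 _ _ _ u)       = u
  ⊢-isCtx (app _ _ _ _ u)     = u
  ⊢-isCtx (lam1 _ u)          = u
  ⊢-isCtx (lam2 _ _ u)        = u
  ⊢-isCtx (oneI _ u)          = u
  ⊢-isCtx (tensorI _ _ _ _ u) = u
  ⊢-isCtx (oneE _ _ _ _ u)    = u
  ⊢-isCtx (tensorE _ _ _ _ u) = u

  -- Rules with an explicit permutation absorb it; the λ-rules and *-introduction
  -- pass it to their premise or to the banged side condition.
  ⊢-exchange : ∀ {Γ Γ' M B} → Γ ⊢ M ∶ B → Γ ↭ Γ' → Γ' ⊢ M ∶ B
  ⊢-exchange (ax1 b s p u) q         = ax1 b s (↭-trans (↭-sym q) p) (IsCtx-resp-↭ u q)
  ⊢-exchange (ax2 b s p u) q         = ax2 b s (↭-trans (↭-sym q) p) (IsCtx-resp-↭ u q)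
  ⊢-exchange (app b d₁ d₂ p u) q     = app b d₁ d₂ (↭-trans (↭-sym q) p) (IsCtx-resp-↭ u q)
  ⊢-exchange (lam1 d u) q            = lam1 (⊢-exchange d (++⁺ʳ _ q)) (IsCtx-resp-↭ u q)
  ⊢-exchange (lam2 b d u) q          =
    lam2 (All-resp-↭ q b) (⊢-exchange d (++⁺ʳ _ q)) (IsCtx-resp-↭ u q)
  ⊢-exchange (oneI b u) q            = oneI (All-resp-↭ q b) (IsCtx-resp-↭ u q)
  ⊢-exchange (tensorI b d₁ d₂ p u) q = tensorI b d₁ d₂ (↭-trans (↭-sym q) p) (IsCtx-resp-↭ u q)
  ⊢-exchange (oneE b d₁ d₂ p u) q    = oneE b d₁ d₂ (↭-trans (↭-sym q) p) (IsCtx-resp-↭ u q)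
  ⊢-exchange (tensorE b d₁ d₂ p u) q = tensorE b d₁ d₂ (↭-trans (↭-sym q) p) (IsCtx-resp-↭ u q)

  unused⇒banged : ∀ {Γ M B x T} → Γ ⊢ M ∶ B → (x , T) ∈ Γ → ¬ FreeIn x M → IsBang T
  unused⇒banged (ax1 {Δ = Δ} b _ p _) x∈ x∉FV with ∈-++⁻ Δ (∈-resp-↭ p x∈)
  ... | inj₁ x∈Δ        = lookup b x∈Δ
  ... | inj₂ (here refl) = ⊥-elim (x∉FV fv-var)
  unused⇒banged (ax2 b _ p _) x∈ _ = lookup b (∈-resp-↭ p x∈)
  unused⇒banged (app {Γ₁ = Γ₁} {Γ₂ = Γ₂} b d₁ d₂ p _) x∈ x∉FV
    with ∈-++⁻ Γ₁ (∈-resp-↭ p x∈)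
  ... | inj₁ x∈Γ₁ = unused⇒banged d₁ (∈-++⁺ˡ x∈Γ₁) (x∉FV ∘ fv-appˡ)
  ... | inj₂ x∈Γ₂Δ with ∈-++⁻ Γ₂ x∈Γ₂Δ
  ...   | inj₁ x∈Γ₂ = unused⇒banged d₂ (∈-++⁺ˡ x∈Γ₂) (x∉FV ∘ fv-appʳ)
  ...   | inj₂ x∈Δ  = lookup b x∈Δ
  unused⇒banged (lam1 {Δ = Δ} d _) x∈ x∉FV =
    unused⇒banged d (∈-++⁺ˡ x∈) (x∉FV ∘ fv-lam x≢binder)
    where x≢binder = distinct-++ Δ (⊢-isCtx d) x∈ (here refl)
  unused⇒banged (lam2 b _ _) x∈ _ = lookup b x∈
  unused⇒banged (oneI b _) x∈ _ = lookup b x∈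
  unused⇒banged (tensorI {Δ = Δ} {Γ₁ = Γ₁} b d₁ d₂ p _) x∈ x∉FV
    with ∈-++⁻ Δ (∈-resp-↭ p x∈)
  ... | inj₁ x∈Δ = lookup b x∈Δ
  ... | inj₂ x∈Γ₁Γ₂ with ∈-++⁻ Γ₁ x∈Γ₁Γ₂
  ...   | inj₁ x∈Γ₁ = unused⇒banged d₁ (∈-++⁺ʳ Δ x∈Γ₁) (x∉FV ∘ fv-pairˡ)
  ...   | inj₂ x∈Γ₂ = unused⇒banged d₂ (∈-++⁺ʳ Δ x∈Γ₂) (x∉FV ∘ fv-pairʳ)
  unused⇒banged (oneE {Δ = Δ} {Γ₁ = Γ₁} b d₁ d₂ p _) x∈ x∉FV
    with ∈-++⁻ Δ (∈-resp-↭ p x∈)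
  ... | inj₁ x∈Δ = lookup b x∈Δ
  ... | inj₂ x∈Γ₁Γ₂ with ∈-++⁻ Γ₁ x∈Γ₁Γ₂
  ...   | inj₁ x∈Γ₁ = unused⇒banged d₁ (∈-++⁺ʳ Δ x∈Γ₁) (x∉FV ∘ fv-letunitˡ)
  ...   | inj₂ x∈Γ₂ = unused⇒banged d₂ (∈-++⁺ʳ Δ x∈Γ₂) (x∉FV ∘ fv-letunitʳ)
  unused⇒banged {x = x} (tensorE {Δ = Δ} {Γ₁ = Γ₁} {Γ₂ = Γ₂} {A₁ = A₁} {A₂ = A₂}
                                 {x₁ = x₁} {x₂ = x₂} {n = n} b d₁ d₂ p _) x∈ x∉FV
    with ∈-++⁻ Δ (∈-resp-↭ p x∈)
  ... | inj₁ x∈Δ = lookup b x∈Δ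
  ... | inj₂ x∈Γ₁Γ₂ with ∈-++⁻ Γ₁ x∈Γ₁Γ₂
  ...   | inj₁ x∈Γ₁ = unused⇒banged d₁ (∈-++⁺ʳ Δ x∈Γ₁) (x∉FV ∘ fv-letpairˡ)
  ...   | inj₂ x∈Γ₂ =
    unused⇒banged d₂ (∈-++⁺ʳ Δ (∈-++⁺ˡ x∈Γ₂))
      (x∉FV ∘ fv-letpairʳ (distinct-binders (here refl)) (distinct-binders (there (here refl))))
    where
      binders : Cx TC
      binders = (x₁ , bangs n A₁) ∷ (x₂ , bangs n A₂) ∷ []
      -- the premise context (Δ ++ Γ₂) ++ binders has distinct variables
      distinct-binders : ∀ {y S} → (y , S) ∈ binders → ¬ x ≡ y
      distinct-binders =
        distinct-++ (Δ ++ Γ₂) (subst IsCtx (sym (++-assoc Δ Γ₂ binders)) (⊢-isCtx d₂))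
                    (∈-++⁺ʳ Δ x∈Γ₂)

  unbound-lam : ∀ {x n y A} {M : Tm TC K} → ¬ BoundIn x (lam n y A M) → ¬ x ≡ y
  unbound-lam x∉BV refl = x∉BV bv-lam

  unbound-let₁ : ∀ {x n y A z C} {M N : Tm TC K} → ¬ BoundIn x (letpair n y A z C M N) → ¬ x ≡ y
  unbound-let₁ x∉BV refl = x∉BV bv-let₁

  unbound-let₂ : ∀ {x n y A z C} {M N : Tm TC K} → ¬ BoundIn x (letpair n y A z C M N) → ¬ x ≡ z
  unbound-let₂ x∉BV refl = x∉BV bv-let₂

  -- The new declaration joins the banged part !Δ of the last
  -- rule, is added to the premises by induction, and moved into place by
  -- exchange; freshness for each premise follows from freshness for the
  -- conclusion context, which the premise contexts make up.
  module _ {x : Var} {A : Ty TC} where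

    X : Var × Ty TC
    X = (x , ! A)

    weaken-! : ∀ {Γ M B} → Γ ⊢ M ∶ B → ¬ BoundIn x M → x # Γ → (Γ ++ [ X ]) ⊢ M ∶ B
    weaken-! (ax1 {Δ = Δ} {x = y} {A = C} b s p u) _ fresh =
      ax1 (Banged-snoc b) s (↭-trans (++⁺ʳ [ X ] p) (shift-last Δ [ (y , C) ] X))
          (IsCtx-snoc fresh u)
    weaken-! (ax2 b s p u) _ fresh =
      ax2 (Banged-snoc b) s (++⁺ʳ [ X ] p) (IsCtx-snoc fresh u)
    weaken-! (app {Γ₁ = Γ₁} {Γ₂ = Γ₂} {Δ = Δ} b d₁ d₂ p u) x∉BV fresh =
      app {Γ₁ = Γ₁} {Γ₂ = Γ₂} (Banged-snoc b)
        (⊢-exchange (weaken-! d₁ (x∉BV ∘ bv-appˡ) (All.++⁺ fresh₁ fresh₃))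
                    (↭-reflexive (++-assoc Γ₁ Δ [ X ])))
        (⊢-exchange (weaken-! d₂ (x∉BV ∘ bv-appʳ) (All.++⁺ fresh₂ fresh₃))
                    (↭-reflexive (++-assoc Γ₂ Δ [ X ])))
        (↭-trans (++⁺ʳ [ X ] p) (↭-reflexive reassoc))
        (IsCtx-snoc fresh u)
      where
        open Fresh-++₃ Γ₁ Γ₂ (All-resp-↭ p fresh)
        reassoc : (Γ₁ ++ Γ₂ ++ Δ) ++ [ X ] ≡ Γ₁ ++ Γ₂ ++ Δ ++ [ X ]
        reassoc = trans (++-assoc Γ₁ (Γ₂ ++ Δ) [ X ])
                    (cong (Γ₁ ++_) (++-assoc Γ₂ Δ [ X ]))
    weaken-! (lam1 {Δ = Δ} {x = y} {A = C} d u) x∉BV fresh =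
      lam1 (⊢-exchange (weaken-! d (x∉BV ∘ bv-lamᵢ) (All.++⁺ fresh (unbound-lam x∉BV ∷ [])))
                       (shift-last Δ [ (y , C) ] X))
           (IsCtx-snoc fresh u)
    weaken-! (lam2 {Δ = Δ} {x = y} {A = C} b d u) x∉BV fresh =
      lam2 (Banged-snoc b)
           (⊢-exchange (weaken-! d (x∉BV ∘ bv-lamᵢ) (All.++⁺ fresh (unbound-lam x∉BV ∷ [])))
                       (shift-last Δ [ (y , C) ] X))
           (IsCtx-snoc fresh u)
    weaken-! (oneI b u) _ fresh = oneI (Banged-snoc b) (IsCtx-snoc fresh u)
    weaken-! (tensorI {Δ = Δ} {Γ₁ = Γ₁} {Γ₂ = Γ₂} b d₁ d₂ p u) x∉BV fresh =
      tensorI {Γ₁ = Γ₁} {Γ₂ = Γ₂} (Banged-snoc b)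
        (⊢-exchange (weaken-! d₁ (x∉BV ∘ bv-pairˡ) (All.++⁺ fresh₁ fresh₂)) (shift-last Δ Γ₁ X))
        (⊢-exchange (weaken-! d₂ (x∉BV ∘ bv-pairʳ) (All.++⁺ fresh₁ fresh₃)) (shift-last Δ Γ₂ X))
        (↭-trans (++⁺ʳ [ X ] p) (shift-last Δ (Γ₁ ++ Γ₂) X)) (IsCtx-snoc fresh u)
      where open Fresh-++₃ Δ Γ₁ (All-resp-↭ p fresh)
    weaken-! (oneE {Δ = Δ} {Γ₁ = Γ₁} {Γ₂ = Γ₂} b d₁ d₂ p u) x∉BV fresh =
      oneE {Γ₁ = Γ₁} {Γ₂ = Γ₂} (Banged-snoc b)
        (⊢-exchange (weaken-! d₁ (x∉BV ∘ bv-unitˡ) (All.++⁺ fresh₁ fresh₂)) (shift-last Δ Γ₁ X))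
        (⊢-exchange (weaken-! d₂ (x∉BV ∘ bv-unitʳ) (All.++⁺ fresh₁ fresh₃)) (shift-last Δ Γ₂ X))
        (↭-trans (++⁺ʳ [ X ] p) (shift-last Δ (Γ₁ ++ Γ₂) X)) (IsCtx-snoc fresh u)
      where open Fresh-++₃ Δ Γ₁ (All-resp-↭ p fresh)
    weaken-! (tensorE {Δ = Δ} {Γ₁ = Γ₁} {Γ₂ = Γ₂} {A₁ = A₁} {A₂ = A₂}
                      {x₁ = x₁} {x₂ = x₂} {n = n} b d₁ d₂ p u) x∉BV fresh =
      tensorE {Γ₁ = Γ₁} {Γ₂ = Γ₂} (Banged-snoc b)
        (⊢-exchange (weaken-! d₁ (x∉BV ∘ bv-letˡ) (All.++⁺ fresh₁ fresh₂)) (shift-last Δ Γ₁ X))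
        (⊢-exchange (weaken-! d₂ (x∉BV ∘ bv-letʳ) (All.++⁺ fresh₁ (All.++⁺ fresh₃ fresh-binders)))
                    (shift-last Δ (Γ₂ ++ binders) X))
        (↭-trans (++⁺ʳ [ X ] p) (shift-last Δ (Γ₁ ++ Γ₂) X)) (IsCtx-snoc fresh u)
      where
        open Fresh-++₃ Δ Γ₁ (All-resp-↭ p fresh)
        binders : Cx TC
        binders = (x₁ , bangs n A₁) ∷ (x₂ , bangs n A₂) ∷ []
        fresh-binders : x # binders
        fresh-binders = unbound-let₁ x∉BV ∷ unbound-let₂ x∉BV ∷ []

-- The theorem: (i) is `unused⇒banged`; (ii) is `weaken-!`, which needs only
-- that x is fresh for Δ and not rebound in M (x ∉ FV(M) then holds anyway).
mainTheorem4 : (TC K : Set) (Aᶜ : K → Ty TC) → let open Typing TC K Aᶜ in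
    (∀ (Δ : Cx TC) (M : Tm TC K) (B : Ty TC) (x : Var) (T : Ty TC) →
      Δ ⊢ M ∶ B → (x , T) ∈ Δ → ¬ FreeIn x M → Σ (Ty TC) (λ A → T ≡ ! A))
    × (∀ (Δ : Cx TC) (M : Tm TC K) (B : Ty TC) (x : Var) →
      Δ ⊢ M ∶ B → ¬ FreeIn x M → ¬ BoundIn x M → x ∉ dom Δ →
      (A : Ty TC) → (Δ ++ [ (x , ! A) ]) ⊢ M ∶ B)
mainTheorem4 TC K Aᶜ = part-i , part-ii
  where
    open UnusedVariables TC K Aᶜ
    part-i = λ Δ M B x T d x∈Δ x∉FV → unused⇒banged d x∈Δ x∉FV
    part-ii = λ Δ M B x d _ x∉BV x∉Δ A → weaken-! {A = A} d x∉BV (∉dom⇒# x∉Δ)
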